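{- Work in Bishop-style constructive mathematics. The following are equivalent: (1) every monotone $\Pi^0_1$ bar of the binary fan $\{0,1\}^*$ is uniform; (2) for every fan $T$, every monotone $\Pi^0_1$ bar of $T$ is uniform; (3) for every fan $T$, every monotone $\Pi^0_1$ bar of the universal spread $\mathbb{N}^*$ is uniform with respect to $T$.
   Context: $\mathbb{N}^*$ is the set of finite sequences of natural numbers, $\{0,1\}^*$ the finite binary sequences, $a*b$ concatenation, $\overline{\alpha}n$ the initial segment of length $n$ of $\alpha$. A tree is an inhabited decidable subset of $\mathbb{N}^*$ closed under initial segments. A spread is a tree $T$ with $\forall a\in T\,\exists n\,(a*\langle n\rangle\in T)$; a path of $T$ is $\alpha$ with $\forall n\,(\overline{\alpha}n\in T)$. A fan is a spread $T$ with $\forall a\in T\,\exists N\,\forall n\,[a*\langle n\rangle\in T\to n\le N]$. For a spread $T$, $P\subseteq T$ is a bar of $T$ if every path $\alpha$ of $T$ has some $n$ with $\overline{\alpha}n\in P$; a uniform bar if there is $N$ such that every path of $T$ has some $n\le N$ with $\overline{\alpha}n\in P$; $\Pi^0_1$ if $P=\bigcap_n B_n$ with each $B_n\subseteq T$ decidable; monotone if $a\in P$, $a*b\in T$ imply $a*b\in P$. The universal spread is $\mathbb{N}^*$. For a fan $T$, a bar $P$ of $\mathbb{N}^*$ is uniform with respect to $T$ if $P\cap T$ is a uniform bar of $T$. -}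

module Defs where

open import Data.Nat using (ℕ; _≤_)
open import Data.Bool using (Bool; true)
open import Data.List using (List; []; _∷_; _++_; [_]; map; upTo)
open import Data.Product using (Σ; ∃; _×_; _,_)
open import Relation.Binary.PropositionalEquality using (_≡_)
open import Function.Bundles using (_⇔_)
open import Level using (suc; zero)

Seq : Set
Seq = List ℕ

DSubset : Set
DSubset = Seq → Bool

_∈ᵈ_ : Seq → DSubset → Set
a ∈ᵈ T = T a ≡ true

init : (ℕ → ℕ) → ℕ → Seq
init α n = map α (upTo n)

IsTree : DSubset → Set
IsTree T = (∃ λ a → a ∈ᵈ T) × (∀ a b → (a ++ b) ∈ᵈ T → a ∈ᵈ T)

IsSpread : DSubset → Set
IsSpread T = IsTree T × (∀ a → a ∈ᵈ T → ∃ λ n → (a ++ [ n ]) ∈ᵈ T)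

IsFan : DSubset → Set
IsFan T = IsSpread T × (∀ a → a ∈ᵈ T → ∃ λ N → ∀ n → (a ++ [ n ]) ∈ᵈ T → n ≤ N)

IsPath : DSubset → (ℕ → ℕ) → Set
IsPath T α = ∀ n → init α n ∈ᵈ T

IsBar : DSubset → (Seq → Set) → Set
IsBar T P = (∀ a → P a → a ∈ᵈ T) × (∀ α → IsPath T α → ∃ λ n → P (init α n))

IsUniformBar : DSubset → (Seq → Set) → Set
IsUniformBar T P =
  (∀ a → P a → a ∈ᵈ T) ×
  (∃ λ N → ∀ α → IsPath T α → ∃ λ n → n ≤ N × P (init α n))

IsΠ⁰₁ : DSubset → (Seq → Set) → Set
IsΠ⁰₁ T P = Σ (ℕ → DSubset) λ B →
  (∀ n a → a ∈ᵈ B n → a ∈ᵈ T) × (∀ a → P a ⇔ (∀ n → a ∈ᵈ B n))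

IsMonotone : DSubset → (Seq → Set) → Set
IsMonotone T P = ∀ a b → P a → (a ++ b) ∈ᵈ T → P (a ++ b)

binary : DSubset
binary [] = true
binary (n ∷ a) = (n Data.Nat.≤ᵇ 1) Data.Bool.∧ binary a

universal : DSubset
universal _ = true

_∩ᵈ_ : (Seq → Set) → DSubset → (Seq → Set)
(P ∩ᵈ T) a = P a × a ∈ᵈ T

Stmt1 : Set₁
Stmt1 = ∀ (P : Seq → Set) → IsMonotone binary P → IsΠ⁰₁ binary P →
        IsBar binary P → IsUniformBar binary P

Stmt2 : Set₁
Stmt2 = ∀ (T : DSubset) → IsFan T → ∀ (P : Seq → Set) →
        IsMonotone T P → IsΠ⁰₁ T P → IsBar T P → IsUniformBar T P

Stmt3 : Set₁
Stmt3 = ∀ (T : DSubset) → IsFan T → ∀ (P : Seq → Set) →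
        IsMonotone universal P → IsΠ⁰₁ universal P → IsBar universal P →
        IsUniformBar T (P ∩ᵈ T)

module Submission where

-- All three nontrivial implications are instances of one transfer principle.
-- Let f : ℕ* → ℕ* send a decidable set S into a tree T, preserve extension of
-- sequences, and grow without bound along every path of S (a "simulation").
-- Then for a monotone Π⁰₁ bar P of T the pullback (P ∘ f) ∩ S is a monotone
-- Π⁰₁ bar of S; and if moreover every path of T is traced, without delay, by
-- the f-image of some path of S, uniformity on S pushes forward to T.
--   (2) ⇒ (3): pull back along the inclusion of a fan T into ℕ*.
--   (3) ⇒ (2): pull back along a retraction of ℕ* onto the fan T.
--   (1) ⇒ (2): pull back along a decoder {0,1}* → T which reads the child
--              to descend to in unary, bounded by the width of the fan.
--   (2) ⇒ (1): the binary tree is a fan.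

open import Defs
open import Data.Bool using (Bool; true; false; _∧_; if_then_else_)
open import Data.Bool.Properties using (T-≡)
open import Data.Empty using (⊥-elim)
open import Data.List using ([]; _∷_; _++_; [_]; map; upTo; foldl; length)
open import Data.List.Properties
  using (foldl-++; map-++; upTo-∷ʳ; length-map; length-upTo; ++-assoc; ++-identityʳ)
open import Data.Nat
  using (ℕ; zero; suc; _+_; _∸_; _≤_; _<_; z≤n; s≤s; s≤s⁻¹; _≤ᵇ_; _≤?_; _≟_)
open import Data.Nat.Properties
  using ( ≤ᵇ⇒≤; ≤-refl; ≤-trans; <⇒≱; ≰⇒>; ≤∧≢⇒<; m≤m+n; m∸n≤m
        ; +-suc; +-identityʳ; +-∸-assoc)
open import Data.Product using (∃; ∃₂; _×_; _,_; proj₁; proj₂)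
open import Function using (_∘_; id)
open import Function.Bundles using (_⇔_; mk⇔; Equivalence)
open import Relation.Nullary using (Dec; yes; no)
open import Relation.Binary.PropositionalEquality
  using (_≡_; refl; sym; trans; cong; subst; module ≡-Reasoning)

open ≡-Reasoning

∧-elim : ∀ {x y} → x ∧ y ≡ true → x ≡ true × y ≡ true
∧-elim {true} {true} refl = refl , refl

∧-intro : ∀ {x y} → x ≡ true → y ≡ true → x ∧ y ≡ true
∧-intro refl refl = refl

_≼_ : Seq → Seq → Set
a ≼ b = ∃ λ d → b ≡ a ++ d

_≺_ : Seq → Seq → Set
a ≺ b = ∃₂ λ x d → b ≡ a ++ x ∷ d

≼-refl : ∀ {a} → a ≼ a
≼-refl {a} = [] , sym (++-identityʳ a)

≼-trans : ∀ {a b c} → a ≼ b → b ≼ c → a ≼ c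
≼-trans {a} (d , refl) (e , refl) = d ++ e , ++-assoc a d e

≺-≼-trans : ∀ {a b c} → a ≺ b → b ≼ c → a ≺ c
≺-≼-trans {a} (x , d , refl) (e , refl) = x , d ++ e , ++-assoc a (x ∷ d) e

≼-≺-trans : ∀ {a b c} → a ≼ b → b ≺ c → a ≺ c
≼-≺-trans {a} ([] , refl) (x , d , refl) = x , d , cong (_++ x ∷ d) (++-identityʳ a)
≼-≺-trans {a} (y ∷ e , refl) (x , d , refl) = y , e ++ x ∷ d , ++-assoc a (y ∷ e) (x ∷ d)

init-suc : ∀ α n → init α (suc n) ≡ init α n ++ [ α n ]
init-suc α n = trans (cong (map α) (sym (upTo-∷ʳ n))) (map-++ α (upTo n) [ n ])

length-init : ∀ α n → length (init α n) ≡ n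
length-init α n = trans (length-map α (upTo n)) (length-upTo n)

init-+ : ∀ α m b → init α (m + b) ≡ init α m ++ init (λ i → α (m + i)) b
init-+ α m zero = trans (cong (init α) (+-identityʳ m)) (sym (++-identityʳ (init α m)))
init-+ α m (suc b) = begin
  init α (m + suc b)                        ≡⟨ cong (init α) (+-suc m b) ⟩
  init α (suc (m + b))                      ≡⟨ init-suc α (m + b) ⟩
  init α (m + b) ++ [ α (m + b) ]           ≡⟨ cong (_++ [ α (m + b) ]) (init-+ α m b) ⟩
  (init α m ++ init α′ b) ++ [ α′ b ]       ≡⟨ ++-assoc (init α m) (init α′ b) [ α′ b ] ⟩
  init α m ++ (init α′ b ++ [ α′ b ])       ≡⟨ cong (init α m ++_) (sym (init-suc α′ b)) ⟩
  init α m ++ init α′ (suc b)               ∎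
  where
  α′ : ℕ → ℕ
  α′ i = α (m + i)

nth : ℕ → Seq → ℕ
nth n [] = 0
nth zero (x ∷ xs) = x
nth (suc n) (x ∷ xs) = nth n xs

nth-length : ∀ a y r → nth (length a) (a ++ y ∷ r) ≡ y
nth-length [] y r = refl
nth-length (x ∷ a) y r = nth-length a y r

limit : (ℕ → Seq) → ℕ → ℕ
limit c n = nth n (c (suc n))

limit-≼ : ∀ c → (∀ n → c n ≺ c (suc n)) → ∀ n → init (limit c) n ≼ c n
limit-≼ c grow zero = c 0 , refl
limit-≼ c grow (suc n) with ≼-≺-trans (limit-≼ c grow n) (grow n)
... | y , r , eq = r , (begin
  c (suc n)                   ≡⟨ eq ⟩
  init α n ++ y ∷ r           ≡⟨ sym (++-assoc (init α n) [ y ] r) ⟩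
  (init α n ++ [ y ]) ++ r    ≡⟨ cong (λ z → (init α n ++ [ z ]) ++ r) (sym αn≡y) ⟩
  (init α n ++ [ α n ]) ++ r  ≡⟨ cong (_++ r) (sym (init-suc α n)) ⟩
  init α (suc n) ++ r         ∎)
  where
  α : ℕ → ℕ
  α = limit c
  αn≡y : α n ≡ y
  αn≡y = begin
    nth n (c (suc n))                       ≡⟨ cong (nth n) eq ⟩
    nth n (init α n ++ y ∷ r)
      ≡⟨ cong (λ m → nth m (init α n ++ y ∷ r)) (sym (length-init α n)) ⟩
    nth (length (init α n)) (init α n ++ y ∷ r) ≡⟨ nth-length (init α n) y r ⟩
    y                                       ∎

module _ {State : Set} (step : State → ℕ → State) where

  run-preserves : (Q : State → Set) → (∀ s x → Q s → Q (step s x)) →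
                  ∀ s xs → Q s → Q (foldl step s xs)
  run-preserves Q pres s [] q = q
  run-preserves Q pres s (x ∷ xs) q = run-preserves Q pres (step s x) xs (pres s x q)

  run-extends : (out : State → Seq) → (∀ s x → out s ≼ out (step s x)) →
                ∀ s a b → out (foldl step s a) ≼ out (foldl step s (a ++ b))
  run-extends out grows s a b =
    subst (λ t → out (foldl step s a) ≼ out t) (sym (foldl-++ step s a b))
      (run-preserves (λ t → out (foldl step s a) ≼ out t) (λ t x h → ≼-trans h (grows t x))
        (foldl step s a) b ≼-refl)

Pull : DSubset → (Seq → Seq) → (Seq → Set) → (Seq → Set)
Pull S f P = (P ∘ f) ∩ᵈ S

record Simulation (S T : DSubset) (f : Seq → Seq) : Set where
  field
    maps-into : ∀ b → b ∈ᵈ S → f b ∈ᵈ T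
    extends   : ∀ a b → f a ≼ f (a ++ b)
    unbounded : ∀ β → IsPath S β →
                ∃ λ (g : ℕ → ℕ) → ∀ n → f (init β (g n)) ≺ f (init β (g (suc n)))

Traces : DSubset → DSubset → (Seq → Seq) → Set
Traces S T f = ∀ α → IsPath T α →
  ∃ λ β → IsPath S β × ∀ m → ∃ λ n → n ≤ m × f (init β m) ≡ init α n

UniformlyBarred : DSubset → (Seq → Set) → Set
UniformlyBarred T P = ∃ λ N → ∀ α → IsPath T α → ∃ λ n → n ≤ N × P (init α n)

module _ {S T : DSubset} {f : Seq → Seq} {P : Seq → Set} where

  pull-Π⁰₁ : IsΠ⁰₁ T P → IsΠ⁰₁ S (Pull S f P)
  pull-Π⁰₁ (B , _ , P⇔B) = B′ , (λ n b h → proj₂ (∧-elim h)) , λ b → mk⇔ (to b) (from b)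
    where
    B′ : ℕ → DSubset
    B′ n b = B n (f b) ∧ S b
    to : ∀ b → Pull S f P b → ∀ n → b ∈ᵈ B′ n
    to b (p , b∈S) n = ∧-intro (Equivalence.to (P⇔B (f b)) p n) b∈S
    from : ∀ b → (∀ n → b ∈ᵈ B′ n) → Pull S f P b
    from b h = Equivalence.from (P⇔B (f b)) (λ n → proj₁ (∧-elim (h n))) , proj₂ (∧-elim (h 0))

  module _ (sim : Simulation S T f) (mono : IsMonotone T P) where
    open Simulation sim

    pull-monotone : IsMonotone S (Pull S f P)
    pull-monotone a b (p , _) ab∈S with extends a b
    ... | d , eq = subst P (sym eq) (mono (f a) d p (subst (_∈ᵈ T) eq (maps-into (a ++ b) ab∈S))) ,
                   ab∈S

    -- A path of S yields, through the limit of its growing f-images, a path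
    -- of T; monotonicity transports the bar back along the chain.
    pull-bar : IsTree T → IsBar T P → IsBar S (Pull S f P)
    pull-bar (_ , closed) (_ , bar) = (λ b → proj₂) , barS
      where
      barS : ∀ β → IsPath S β → ∃ λ n → Pull S f P (init β n)
      barS β β∈S = g k , subst P (sym (proj₂ (approx k))) P-at-k , β∈S (g k)
        where
        g : ℕ → ℕ
        g = proj₁ (unbounded β β∈S)
        chain : ℕ → Seq
        chain n = f (init β (g n))
        chain∈T : ∀ n → chain n ∈ᵈ T
        chain∈T n = maps-into (init β (g n)) (β∈S (g n))
        approx : ∀ n → init (limit chain) n ≼ chain n
        approx = limit-≼ chain (proj₂ (unbounded β β∈S))
        α-path : IsPath T (limit chain)
        α-path n = closed (init (limit chain) n) (proj₁ (approx n))
                     (subst (_∈ᵈ T) (proj₂ (approx n)) (chain∈T n))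
        k : ℕ
        k = proj₁ (bar (limit chain) α-path)
        P-at-k : P (init (limit chain) k ++ proj₁ (approx k))
        P-at-k = mono (init (limit chain) k) (proj₁ (approx k)) (proj₂ (bar (limit chain) α-path))
                   (subst (_∈ᵈ T) (proj₂ (approx k)) (chain∈T k))

push-uniform : ∀ {S T f} {P Q : Seq → Set} → UniformlyBarred S Q → (∀ b → Q b → P (f b)) →
               Traces S T f → UniformlyBarred T P
push-uniform {P = P} (N , unif) Q⇒P low = N , λ α α∈T →
  let (β , β∈S , traced) = low α α∈T
      (m , m≤N , q) = unif β β∈S
      (n , n≤m , eq) = traced m
  in n , ≤-trans n≤m m≤N , subst P eq (Q⇒P (init β m) q)

universal-tree : IsTree universal
universal-tree = ([] , refl) , (λ _ _ _ → refl)

inclusion : ∀ {T} → Simulation T universal id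
inclusion = record
  { maps-into = λ _ _ → refl
  ; extends   = λ a b → b , refl
  ; unbounded = λ β _ → (λ n → n) , λ n → β n , [] , init-suc β n
  }

witnessIf : ∀ {Q : ℕ → Set} (b : Bool) → (b ≡ true → ∃ Q) → ℕ
witnessIf true w = proj₁ (w refl)
witnessIf false w = 0

witnessIf-ok : ∀ {Q : ℕ → Set} b (w : b ≡ true → ∃ Q) → b ≡ true → Q (witnessIf b w)
witnessIf-ok true w refl = proj₂ (w refl)

module FanChoice {T : DSubset} (fan : IsFan T) where

  tree : IsTree T
  tree = proj₁ (proj₁ fan)

  root : [] ∈ᵈ T
  root with proj₁ tree
  ... | a , a∈T = proj₂ tree [] a a∈T

  someChild : Seq → ℕ
  someChild a = witnessIf (T a) (proj₂ (proj₁ fan) a)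

  someChild-∈ : ∀ {a} → a ∈ᵈ T → (a ++ [ someChild a ]) ∈ᵈ T
  someChild-∈ {a} = witnessIf-ok (T a) (proj₂ (proj₁ fan) a)

  width : Seq → ℕ
  width a = witnessIf (T a) (proj₂ fan a)

  width-bound : ∀ {a n} → a ∈ᵈ T → (a ++ [ n ]) ∈ᵈ T → n ≤ width a
  width-bound {a} {n} a∈T = witnessIf-ok (T a) (proj₂ fan a) a∈T n

  child : Seq → ℕ → ℕ
  child a k = if T (a ++ [ k ]) then k else someChild a

  child-∈ : ∀ {a} k → a ∈ᵈ T → (a ++ [ child a k ]) ∈ᵈ T
  child-∈ {a} k a∈T with T (a ++ [ k ]) in eq
  ... | true = eq
  ... | false = someChild-∈ a∈T

  child-of-child : ∀ {a k} → (a ++ [ k ]) ∈ᵈ T → child a k ≡ k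
  child-of-child ak∈T rewrite ak∈T = refl

-- The retraction of ℕ* onto a fan T: follow the input while it stays in T,
-- otherwise divert to some child.
module Retraction {T : DSubset} (fan : IsFan T) where
  open FanChoice fan

  retractStep : Seq → ℕ → Seq
  retractStep a x = a ++ [ child a x ]

  retract : Seq → Seq
  retract = foldl retractStep []

  retract-suc : ∀ α n → retract (init α (suc n)) ≡ retractStep (retract (init α n)) (α n)
  retract-suc α n =
    trans (cong retract (init-suc α n)) (foldl-++ retractStep [] (init α n) [ α n ])

  retract-simulation : Simulation universal T retract
  retract-simulation = record
    { maps-into = λ b _ → run-preserves retractStep (_∈ᵈ T) (λ a x → child-∈ x) [] b root
    ; extends   = run-extends retractStep id (λ a x → [ child a x ] , refl) []
    ; unbounded = λ β _ → (λ n → n) ,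
                    λ n → child (retract (init β n)) (β n) , [] , retract-suc β n
    }

  retract-fixes : ∀ α → IsPath T α → ∀ n → retract (init α n) ≡ init α n
  retract-fixes α α∈T zero = refl
  retract-fixes α α∈T (suc n) = begin
    retract (init α (suc n))                       ≡⟨ retract-suc α n ⟩
    retract (init α n) ++ [ child (retract (init α n)) (α n) ]
      ≡⟨ cong (λ a → a ++ [ child a (α n) ]) (retract-fixes α α∈T n) ⟩
    init α n ++ [ child (init α n) (α n) ]
      ≡⟨ cong (λ k → init α n ++ [ k ]) (child-of-child αn∈T) ⟩
    init α n ++ [ α n ]                            ≡⟨ sym (init-suc α n) ⟩
    init α (suc n)                                 ∎
    where
    αn∈T : (init α n ++ [ α n ]) ∈ᵈ T
    αn∈T = subst (_∈ᵈ T) (init-suc α n) (α∈T (suc n))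

  retract-traces : Traces T T retract
  retract-traces α α∈T = α , α∈T , λ m → m , ≤-refl , retract-fixes α α∈T m

-- Its state is the node reached together
-- with a proposed child k; bit 0 descends to (a child selected by) k, bit 1
-- proposes k + 1, except that once k reaches the width of the node every bit
-- descends.  Hence every width + 1 bits force a descent.
module Decoding {T : DSubset} (fan : IsFan T) where
  open FanChoice fan

  State : Set
  State = Seq × ℕ

  start : State
  start = [] , 0

  descend : Seq → ℕ → State
  descend a k = a ++ [ child a k ] , 0

  decodeStep : (a : Seq) (k x : ℕ) → Dec (width a ≤ k) → State
  decodeStep a k zero _ = descend a k
  decodeStep a k (suc _) (yes _) = descend a k
  decodeStep a k (suc _) (no _) = a , suc k

  step : State → ℕ → State
  step (a , k) x = decodeStep a k x (width a ≤? k)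

  decode : Seq → Seq
  decode b = proj₁ (foldl step start b)

  decodeStep-∈ : ∀ a k x d → a ∈ᵈ T → proj₁ (decodeStep a k x d) ∈ᵈ T
  decodeStep-∈ a k zero _ a∈T = child-∈ k a∈T
  decodeStep-∈ a k (suc _) (yes _) a∈T = child-∈ k a∈T
  decodeStep-∈ a k (suc _) (no _) a∈T = a∈T

  decodeStep-≼ : ∀ a k x d → a ≼ proj₁ (decodeStep a k x d)
  decodeStep-≼ a k zero _ = [ child a k ] , refl
  decodeStep-≼ a k (suc _) (yes _) = [ child a k ] , refl
  decodeStep-≼ a k (suc _) (no _) = ≼-refl

  step-≼ : ∀ s x → proj₁ s ≼ proj₁ (step s x)
  step-≼ (a , k) x = decodeStep-≼ a k x (width a ≤? k)

  progress : ∀ a k b → width a ∸ k < length b → a ≺ proj₁ (foldl step (a , k) b)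
  progress a k (x ∷ b) h = go x (width a ≤? k)
    where
    after : ∀ s → proj₁ s ≼ proj₁ (foldl step s b)
    after s = run-extends step proj₁ step-≼ s [] b
    go : ∀ x d → a ≺ proj₁ (foldl step (decodeStep a k x d) b)
    go zero _ = ≺-≼-trans (child a k , [] , refl) (after (descend a k))
    go (suc _) (yes _) = ≺-≼-trans (child a k , [] , refl) (after (descend a k))
    go (suc _) (no k≮w) = progress a (suc k) b (s≤s⁻¹ (subst (_< suc (length b)) gap h))
      where
      gap : width a ∸ k ≡ suc (width a ∸ suc k)
      gap = +-∸-assoc 1 (≰⇒> k≮w)

  module Blocks (β : ℕ → ℕ) where
    blockEnd : ℕ → ℕ
    blockEnd zero = 0
    blockEnd (suc n) = blockEnd n + suc (width (decode (init β (blockEnd n))))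

    decode-grows : ∀ n → decode (init β (blockEnd n)) ≺ decode (init β (blockEnd (suc n)))
    decode-grows n = subst (a ≺_) (sym reads) (progress a k block enough)
      where
      m : ℕ
      m = blockEnd n
      a : Seq
      a = decode (init β m)
      k : ℕ
      k = proj₂ (foldl step start (init β m))
      block : Seq
      block = init (λ i → β (m + i)) (suc (width a))
      enough : width a ∸ k < length block
      enough = subst (width a ∸ k <_) (sym (length-init _ (suc (width a))))
                 (s≤s (m∸n≤m (width a) k))
      reads : decode (init β (blockEnd (suc n))) ≡ proj₁ (foldl step (a , k) block)
      reads = begin
        decode (init β (m + suc (width a)))  ≡⟨ cong decode (init-+ β m (suc (width a))) ⟩
        decode (init β m ++ block)           ≡⟨ cong proj₁ (foldl-++ step start (init β m) block) ⟩
        proj₁ (foldl step (a , k) block)     ∎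

  decode-simulation : Simulation binary T decode
  decode-simulation = record
    { maps-into = λ b _ → run-preserves step (λ s → proj₁ s ∈ᵈ T)
                    (λ { (a , k) x → decodeStep-∈ a k x (width a ≤? k) }) start b root
    ; extends   = run-extends step proj₁ step-≼ start
    ; unbounded = λ β _ → Blocks.blockEnd β , Blocks.decode-grows β
    }

  -- Encoding a path α of T: at position (j , k) the bits 1^(α j) 0 for the
  -- j-th entry have been emitted up to count k.
  module Encoding (α : ℕ → ℕ) (α∈T : IsPath T α) where
    Complete : ℕ × ℕ → Set
    Complete (j , k) = k ≡ α j

    complete? : ∀ p → Dec (Complete p)
    complete? (j , k) = k ≟ α j

    bit : ∀ {p} → Dec (Complete p) → ℕ
    bit (yes _) = 0
    bit (no _) = 1

    advance : ∀ p → Dec (Complete p) → ℕ × ℕ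
    advance (j , k) (yes _) = suc j , 0
    advance (j , k) (no _) = j , suc k

    position : ℕ → ℕ × ℕ
    position zero = 0 , 0
    position (suc m) = advance (position m) (complete? (position m))

    β : ℕ → ℕ
    β m = bit (complete? (position m))

    at : ℕ × ℕ → State
    at (j , k) = init α j , k

    Within : ℕ → ℕ × ℕ → Set
    Within m (j , k) = k ≤ α j × j + k ≤ m

    αj∈T : ∀ j → (init α j ++ [ α j ]) ∈ᵈ T
    αj∈T j = subst (_∈ᵈ T) (init-suc α j) (α∈T (suc j))

    skip : ∀ a k → k < width a → decodeStep a k 1 (width a ≤? k) ≡ (a , suc k)
    skip a k k<w with width a ≤? k
    ... | yes w≤k = ⊥-elim (<⇒≱ k<w w≤k)
    ... | no _ = refl

    advance-step : ∀ {m} p (d : Dec (Complete p)) → Within m p →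
                   step (at p) (bit d) ≡ at (advance p d) × Within (suc m) (advance p d)
    advance-step {m} (j , k) (yes refl) (_ , jk≤m) = descends , z≤n , s≤s j+0≤m
      where
      j+0≤m : j + 0 ≤ m
      j+0≤m = subst (_≤ m) (sym (+-identityʳ j)) (≤-trans (m≤m+n j k) jk≤m)
      descends : descend (init α j) k ≡ (init α (suc j) , 0)
      descends = cong (_, 0) (begin
        init α j ++ [ child (init α j) k ]
          ≡⟨ cong (λ z → init α j ++ [ z ]) (child-of-child (αj∈T j)) ⟩
        init α j ++ [ α j ]                  ≡⟨ sym (init-suc α j) ⟩
        init α (suc j)                       ∎)
    advance-step {m} (j , k) (no k≢αj) (k≤αj , jk≤m) =
      skip (init α j) k (≤-trans k<αj (width-bound (α∈T j) (αj∈T j))) , k<αj ,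
      subst (_≤ suc m) (sym (+-suc j k)) (s≤s jk≤m)
      where
      k<αj : k < α j
      k<αj = ≤∧≢⇒< k≤αj k≢αj

    decodes-encoding : ∀ m → foldl step start (init β m) ≡ at (position m) × Within m (position m)
    decodes-encoding zero = refl , z≤n , z≤n
    decodes-encoding (suc m) with decodes-encoding m
    ... | eq , within with advance-step (position m) (complete? (position m)) within
    ... | eq′ , within′ = (begin
      foldl step start (init β (suc m))          ≡⟨ cong (foldl step start) (init-suc β m) ⟩
      foldl step start (init β m ++ [ β m ])     ≡⟨ foldl-++ step start (init β m) [ β m ] ⟩
      step (foldl step start (init β m)) (β m)   ≡⟨ cong (λ s → step s (β m)) eq ⟩
      step (at (position m)) (β m)               ≡⟨ eq′ ⟩
      at (position (suc m))                      ∎) , within′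

    bit-binary : ∀ {p} (d : Dec (Complete p)) → (bit d ≤ᵇ 1) ≡ true
    bit-binary (yes _) = refl
    bit-binary (no _) = refl

    β-binary : IsPath binary β
    β-binary n = bits (upTo n)
      where
      bits : ∀ l → map β l ∈ᵈ binary
      bits [] = refl
      bits (i ∷ l) = ∧-intro (bit-binary (complete? (position i))) (bits l)

  decode-traces : Traces binary T decode
  decode-traces α α∈T = β , β-binary , λ m →
    let (eq , _ , jk≤m) = decodes-encoding m
    in proj₁ (position m) , ≤-trans (m≤m+n _ _) jk≤m , cong proj₁ eq
    where open Encoding α α∈T

binary-closed : ∀ a b → (a ++ b) ∈ᵈ binary → a ∈ᵈ binary
binary-closed [] b _ = refl
binary-closed (n ∷ a) b h = ∧-intro (proj₁ (∧-elim h)) (binary-closed a b (proj₂ (∧-elim h)))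

binary-zero : ∀ a → a ∈ᵈ binary → (a ++ [ 0 ]) ∈ᵈ binary
binary-zero [] _ = refl
binary-zero (n ∷ a) h = ∧-intro (proj₁ (∧-elim h)) (binary-zero a (proj₂ (∧-elim h)))

binary-bit : ∀ a n → (a ++ [ n ]) ∈ᵈ binary → n ≤ 1
binary-bit [] n h = ≤ᵇ⇒≤ n 1 (Equivalence.from T-≡ (proj₁ (∧-elim h)))
binary-bit (m ∷ a) n h = binary-bit a n (proj₂ (∧-elim {m ≤ᵇ 1} h))

binary-fan : IsFan binary
binary-fan =
  ((([] , refl) , binary-closed) , λ a h → 0 , binary-zero a h) , λ a _ → 1 , binary-bit a

stmt1⇒stmt2 : Stmt1 → Stmt2
stmt1⇒stmt2 uniform₁ T fan P mono π bar =
  proj₁ bar , push-uniform {binary} {T} {decode} {P} uniformly lands decode-traces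
  where
  open FanChoice fan using (tree)
  open Decoding fan
  lands : ∀ b → Pull binary decode P b → P (decode b)
  lands b = proj₁
  uniformly : UniformlyBarred binary (Pull binary decode P)
  uniformly = proj₂ (uniform₁ (Pull binary decode P)
    (pull-monotone decode-simulation mono) (pull-Π⁰₁ π) (pull-bar decode-simulation mono tree bar))

stmt2⇒stmt1 : Stmt2 → Stmt1
stmt2⇒stmt1 uniform₂ = uniform₂ binary binary-fan

-- (2) ⇒ (3): restricting a bar of ℕ* to T is pulling it back along T ⊆ ℕ*.
stmt2⇒stmt3 : Stmt2 → Stmt3
stmt2⇒stmt3 uniform₂ T fan P mono π bar =
  uniform₂ T fan (Pull T id P)
    (pull-monotone inclusion mono) (pull-Π⁰₁ π) (pull-bar inclusion mono universal-tree bar)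

stmt3⇒stmt2 : Stmt3 → Stmt2
stmt3⇒stmt2 uniform₃ T fan P mono π bar =
  proj₁ bar , push-uniform {T} {T} {retract} {P} uniformly lands retract-traces
  where
  open FanChoice fan using (tree)
  open Retraction fan
  lands : ∀ b → (Pull universal retract P ∩ᵈ T) b → P (retract b)
  lands b = proj₁ ∘ proj₁
  uniformly : UniformlyBarred T (Pull universal retract P ∩ᵈ T)
  uniformly = proj₂ (uniform₃ T fan (Pull universal retract P)
    (pull-monotone retract-simulation mono) (pull-Π⁰₁ π) (pull-bar retract-simulation mono tree bar))

corollary2p3 : (Stmt1 ⇔ Stmt2) × (Stmt2 ⇔ Stmt3)
corollary2p3 = mk⇔ stmt1⇒stmt2 stmt2⇒stmt1 , mk⇔ stmt2⇒stmt3 stmt3⇒stmt2
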